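{- Let $\Gamma=(V,E)$ be a simple oriented graph and let $v,w\in F(V)$ with $w\stackrel{*}{\longrightarrow} v$. If $\widetilde{w}\in F(V)$ satisfies $\widetilde{w}\sim w$, then there exists $\widetilde{v}\in F(V)$ with $\widetilde{v}\sim v$ and $\widetilde{w}\stackrel{*}{\longrightarrow}\widetilde{v}$.
   Context: A simple oriented graph $\Gamma=(V,E)$ is a directed graph with vertex set $V$ and arrow set $E\subseteq V\times V$ having no self-loops and no oriented cycles of length $2$; write $a\to b$ for $(a,b)\in E$. $F(V)$ is the free monoid on $V$; elements of $V$ are letters. Elementary cancellations on words: for $w_1,w_2,u\in F(V)$ and $a\in V$, a right cancellation is $w_1auaw_2\longrightarrow w_1auw_2$, allowed if no letter of $u$ has an arrow to $a$; a left cancellation is $w_1auaw_2\longrightarrow w_1uaw_2$, allowed if no letter of $u$ has an arrow from $a$. The relation $\longrightarrow$ is the union of right and left cancellations, and $\stackrel{*}{\longrightarrow}$ is its reflexive-transitive closure. Two letters $a,b$ are disconnected if neither $a\to b$ nor $b\to a$. The equivalence relation $\sim$ on $F(V)$ is generated by elementary commutations $w_1abw_2\sim w_1baw_2$ with $w_1,w_2\in F(V)$ and $a,b$ disconnected letters. -}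

module Defs where

open import Level using (Level; _⊔_; suc)
open import Data.List using (List; []; _∷_; _++_)
open import Data.List.Relation.Unary.All using (All)
open import Data.Product using (_×_)
open import Relation.Nullary using (¬_)
open import Relation.Binary.Construct.Closure.ReflexiveTransitive using (Star)
open import Relation.Binary.Construct.Closure.Equivalence using (EqClosure)

record SimpleOrientedGraph (a ℓ : Level) : Set (suc (a ⊔ ℓ)) where
  field
    V       : Set a
    _⇒_     : V → V → Set ℓ
    noLoop  : ∀ x → ¬ (x ⇒ x)
    no2Cyc  : ∀ x y → x ⇒ y → ¬ (y ⇒ x)

module _ {a ℓ : Level} (Γ : SimpleOrientedGraph a ℓ) where
  open SimpleOrientedGraph Γ

  Word : Set a
  Word = List V

  data _⟶_ : Word → Word → Set (a ⊔ ℓ) where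
    rightCancel : ∀ w₁ w₂ u x → All (λ y → ¬ (y ⇒ x)) u →
      (w₁ ++ x ∷ u ++ x ∷ w₂) ⟶ (w₁ ++ x ∷ u ++ w₂)
    leftCancel  : ∀ w₁ w₂ u x → All (λ y → ¬ (x ⇒ y)) u →
      (w₁ ++ x ∷ u ++ x ∷ w₂) ⟶ (w₁ ++ u ++ x ∷ w₂)

  _⟶*_ : Word → Word → Set (a ⊔ ℓ)
  _⟶*_ = Star _⟶_

  Disconnected : V → V → Set ℓ
  Disconnected x y = ¬ (x ⇒ y) × ¬ (y ⇒ x)

  data Commute : Word → Word → Set (a ⊔ ℓ) where
    commute : ∀ w₁ w₂ x y → Disconnected x y →
      Commute (w₁ ++ x ∷ y ∷ w₂) (w₁ ++ y ∷ x ∷ w₂)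

  _∼_ : Word → Word → Set (a ⊔ ℓ)
  _∼_ = EqClosure Commute

-- Proof idea: a single commutation can be pushed past a single cancellation.
-- If p is obtained from q by swapping two adjacent disconnected letters and
-- q ⟶ r, then p ⟶ s for some s that equals r or differs from it by one
-- swap. Iterating this local diamond over the chain of commutations w̃ ∼ w
-- and then over the cancellation sequence w ⟶* v gives the theorem.
module Submission where

open import Defs
open import Level using (Level; _⊔_)
open import Data.Product using (∃; _×_; _,_; proj₁; proj₂; Σ-syntax)
open import Data.List using ([]; _∷_; _++_)
open import Data.List.Relation.Unary.All using (All; []; _∷_)
open import Relation.Nullary using (¬_)
open import Relation.Binary.Core using (Rel)
open import Relation.Binary.PropositionalEquality using (_≡_; refl)
open import Relation.Binary.Construct.Closure.ReflexiveTransitive using (Star; ε; _◅_; _◅◅_)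
open import Relation.Binary.Construct.Closure.Symmetric using (SymClosure; fwd; bwd)
open import Relation.Binary.Construct.Closure.Reflexive using (ReflClosure; refl; [_])
open import Relation.Binary.Construct.Closure.Equivalence using (EqClosure; return)

module StepCommutation {a ℓ₁ ℓ₂ : Level} {A : Set a}
                       (_~_ : Rel A ℓ₁) (_↝_ : Rel A ℓ₂) where

  StepCommutes : Set (a ⊔ ℓ₁ ⊔ ℓ₂)
  StepCommutes = ∀ {p q r} → SymClosure _~_ p q → q ↝ r →
                 ∃ λ s → EqClosure _~_ s r × p ↝ s

  module _ (commutes : StepCommutes) where

    commute-step : ∀ {p q r} → EqClosure _~_ p q → q ↝ r →
                   ∃ λ s → EqClosure _~_ s r × p ↝ s
    commute-step ε       q↝r = _ , ε , q↝r
    commute-step (c ◅ e) q↝r with commute-step e q↝r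
    ... | s , s~r , ↝s with commutes c ↝s
    ...   | t , t~s , ↝t = t , t~s ◅◅ s~r , ↝t

    commute-steps : ∀ {p q r} → EqClosure _~_ p q → Star _↝_ q r →
                    ∃ λ s → EqClosure _~_ s r × Star _↝_ p s
    commute-steps p~q ε = _ , p~q , ε
    commute-steps p~q (q↝q′ ◅ q′↝*r) with commute-step p~q q↝q′
    ... | s , s~q′ , p↝s with commute-steps s~q′ q′↝*r
    ...   | t , t~r , s↝*t = t , t~r , p↝s ◅ s↝*t

module _ {a ℓ : Level} (Γ : SimpleOrientedGraph a ℓ) where
  open SimpleOrientedGraph Γ

  -- Cancellations and commutations with the prefix w₁ peeled off letter by
  -- letter (constructor there). RightCancellable c q r says q = u ++ c ∷ w
  -- and r = u ++ w with no letter of u pointing to c, so that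
  -- c ∷ q ⟶ c ∷ r; LeftCancellable c q says the same with no letter of u
  -- pointed to by c, so that c ∷ q ⟶ q.
  data RightCancellable (c : V) : Word Γ → Word Γ → Set (a ⊔ ℓ) where
    here : ∀ {w} → RightCancellable c (c ∷ w) w
    skip : ∀ {z q r} → ¬ (z ⇒ c) → RightCancellable c q r →
           RightCancellable c (z ∷ q) (z ∷ r)

  data LeftCancellable (c : V) : Word Γ → Set (a ⊔ ℓ) where
    here : ∀ {w} → LeftCancellable c (c ∷ w)
    skip : ∀ {z q} → ¬ (c ⇒ z) → LeftCancellable c q →
           LeftCancellable c (z ∷ q)

  data Cancel : Word Γ → Word Γ → Set (a ⊔ ℓ) where
    right : ∀ {c q r} → RightCancellable c q r → Cancel (c ∷ q) (c ∷ r)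
    left  : ∀ {c q} → LeftCancellable c q → Cancel (c ∷ q) q
    there : ∀ {z q r} → Cancel q r → Cancel (z ∷ q) (z ∷ r)

  data Swap : Word Γ → Word Γ → Set (a ⊔ ℓ) where
    here  : ∀ {x y w} → Disconnected Γ x y → Swap (x ∷ y ∷ w) (y ∷ x ∷ w)
    there : ∀ {z p q} → Swap p q → Swap (z ∷ p) (z ∷ q)

  Swap-sym : ∀ {p q} → Swap p q → Swap q p
  Swap-sym (here (x⇏y , y⇏x)) = here (y⇏x , x⇏y)
  Swap-sym (there s)          = there (Swap-sym s)

  there? : ∀ {z p q} → ReflClosure Swap p q → ReflClosure Swap (z ∷ p) (z ∷ q)
  there? refl  = refl
  there? [ s ] = [ there s ]

  RightCancellable-swap : ∀ {c p q r} → Swap p q → RightCancellable c q r →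
                          ∃ λ s → RightCancellable c p s × ReflClosure Swap s r
  RightCancellable-swap (here d) here                     = _ , skip (proj₁ d) here , refl
  RightCancellable-swap (here d) (skip _ here)            = _ , here , refl
  RightCancellable-swap (here d) (skip y⇏c (skip x⇏c rc)) = _ , skip x⇏c (skip y⇏c rc) , [ here d ]
  RightCancellable-swap (there s) here                    = _ , here , [ s ]
  RightCancellable-swap (there s) (skip z⇏c rc) with RightCancellable-swap s rc
  ... | t , rc′ , t≈r = _ , skip z⇏c rc′ , there? t≈r

  LeftCancellable-swap : ∀ {c p q} → Swap p q → LeftCancellable c q → LeftCancellable c p
  LeftCancellable-swap (here d) here                     = skip (proj₂ d) here
  LeftCancellable-swap (here d) (skip _ here)            = here
  LeftCancellable-swap (here d) (skip c⇏y (skip c⇏x lc)) = skip c⇏x (skip c⇏y lc)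
  LeftCancellable-swap (there s) here                    = here
  LeftCancellable-swap (there s) (skip c⇏z lc)           = skip c⇏z (LeftCancellable-swap s lc)

  -- The cases where the swap involves the cancelled letter c itself are the
  -- ones using disconnectedness: c moves across a letter it has no arrow
  -- to or from, which keeps the cancellation legal.
  Swap-Cancel-diamond : ∀ {p q r} → Swap p q → Cancel q r →
                        ∃ λ s → ReflClosure Swap s r × Cancel p s
  Swap-Cancel-diamond (here d)  (right here)         = _ , refl , right here
  Swap-Cancel-diamond (here d)  (right (skip _ rc))  = _ , [ here d ] , there (right rc)
  Swap-Cancel-diamond (here d)  (left here)          = _ , refl , left here
  Swap-Cancel-diamond (here d)  (left (skip _ lc))   = _ , refl , there (left lc)
  Swap-Cancel-diamond (here d)  (there (right rc))   = _ , [ here d ] , right (skip (proj₂ d) rc)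
  Swap-Cancel-diamond (here d)  (there (left lc))    = _ , refl , left (skip (proj₁ d) lc)
  Swap-Cancel-diamond (here d)  (there (there cn))   = _ , [ here d ] , there (there cn)
  Swap-Cancel-diamond (there s) (right rc) with RightCancellable-swap s rc
  ... | t , rc′ , t≈r = _ , there? t≈r , right rc′
  Swap-Cancel-diamond (there s) (left lc)            = _ , [ s ] , left (LeftCancellable-swap s lc)
  Swap-Cancel-diamond (there s) (there cn) with Swap-Cancel-diamond s cn
  ... | t , t≈r , cn′ = _ , there? t≈r , there cn′

  RightCancellable-++ : ∀ {c} u w → All (λ y → ¬ (y ⇒ c)) u →
                        RightCancellable c (u ++ c ∷ w) (u ++ w)
  RightCancellable-++ []      w []           = here
  RightCancellable-++ (_ ∷ u) w (z⇏c ∷ u⇏c) = skip z⇏c (RightCancellable-++ u w u⇏c)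

  LeftCancellable-++ : ∀ {c} u w → All (λ y → ¬ (c ⇒ y)) u →
                       LeftCancellable c (u ++ c ∷ w)
  LeftCancellable-++ []      w []           = here
  LeftCancellable-++ (_ ∷ u) w (c⇏z ∷ c⇏u) = skip c⇏z (LeftCancellable-++ u w c⇏u)

  RightCancellable-split : ∀ {c q r} → RightCancellable c q r →
    Σ[ u ∈ Word Γ ] Σ[ w ∈ Word Γ ]
      All (λ y → ¬ (y ⇒ c)) u × q ≡ u ++ c ∷ w × r ≡ u ++ w
  RightCancellable-split (here {w}) = [] , w , [] , refl , refl
  RightCancellable-split (skip z⇏c rc) with RightCancellable-split rc
  ... | u , w , u⇏c , refl , refl = _ ∷ u , w , z⇏c ∷ u⇏c , refl , refl

  LeftCancellable-split : ∀ {c q} → LeftCancellable c q →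
    Σ[ u ∈ Word Γ ] Σ[ w ∈ Word Γ ] All (λ y → ¬ (c ⇒ y)) u × q ≡ u ++ c ∷ w
  LeftCancellable-split (here {w}) = [] , w , [] , refl
  LeftCancellable-split (skip c⇏z lc) with LeftCancellable-split lc
  ... | u , w , c⇏u , refl = _ ∷ u , w , c⇏z ∷ c⇏u , refl

  Cancel-prefix : ∀ w₁ {p q} → Cancel p q → Cancel (w₁ ++ p) (w₁ ++ q)
  Cancel-prefix []       cn = cn
  Cancel-prefix (_ ∷ w₁) cn = there (Cancel-prefix w₁ cn)

  Swap-prefix : ∀ w₁ {p q} → Swap p q → Swap (w₁ ++ p) (w₁ ++ q)
  Swap-prefix []       s = s
  Swap-prefix (_ ∷ w₁) s = there (Swap-prefix w₁ s)

  ⟶-cons : ∀ {z p q} → _⟶_ Γ p q → _⟶_ Γ (z ∷ p) (z ∷ q)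
  ⟶-cons {z} (rightCancel w₁ w₂ u x u⇏x) = rightCancel (z ∷ w₁) w₂ u x u⇏x
  ⟶-cons {z} (leftCancel  w₁ w₂ u x x⇏u) = leftCancel  (z ∷ w₁) w₂ u x x⇏u

  ⟶⇒Cancel : ∀ {p q} → _⟶_ Γ p q → Cancel p q
  ⟶⇒Cancel (rightCancel w₁ w₂ u x u⇏x) = Cancel-prefix w₁ (right (RightCancellable-++ u w₂ u⇏x))
  ⟶⇒Cancel (leftCancel  w₁ w₂ u x x⇏u) = Cancel-prefix w₁ (left (LeftCancellable-++ u w₂ x⇏u))

  Cancel⇒⟶ : ∀ {p q} → Cancel p q → _⟶_ Γ p q
  Cancel⇒⟶ (right rc) with RightCancellable-split rc
  ... | u , w , u⇏c , refl , refl = rightCancel [] w u _ u⇏c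
  Cancel⇒⟶ (left lc) with LeftCancellable-split lc
  ... | u , w , c⇏u , refl = leftCancel [] w u _ c⇏u
  Cancel⇒⟶ (there cn) = ⟶-cons (Cancel⇒⟶ cn)

  Commute⇒Swap : ∀ {p q} → Commute Γ p q → Swap p q
  Commute⇒Swap (commute w₁ w₂ x y d) = Swap-prefix w₁ (here d)

  Swap⇒Commute : ∀ {p q} → Swap p q → Commute Γ p q
  Swap⇒Commute (here d) = commute [] _ _ _ d
  Swap⇒Commute (there s) with Swap⇒Commute s
  ... | commute w₁ w₂ x y d = commute (_ ∷ w₁) w₂ x y d

  SymCommute⇒Swap : ∀ {p q} → SymClosure (Commute Γ) p q → Swap p q
  SymCommute⇒Swap (fwd c) = Commute⇒Swap c
  SymCommute⇒Swap (bwd c) = Swap-sym (Commute⇒Swap c)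

  ReflSwap⇒∼ : ∀ {p q} → ReflClosure Swap p q → _∼_ Γ p q
  ReflSwap⇒∼ refl  = ε
  ReflSwap⇒∼ [ s ] = return (Swap⇒Commute s)

  Commute-⟶-commutes : StepCommutation.StepCommutes (Commute Γ) (_⟶_ Γ)
  Commute-⟶-commutes c q⟶r with Swap-Cancel-diamond (SymCommute⇒Swap c) (⟶⇒Cancel q⟶r)
  ... | s , s≈r , cn = s , ReflSwap⇒∼ s≈r , Cancel⇒⟶ cn

mainTheorem2 : ∀ {a ℓ : Level} (Γ : SimpleOrientedGraph a ℓ) →
    (v w w̃ : Word Γ) → _⟶*_ Γ w v → _∼_ Γ w̃ w →
    ∃ λ (ṽ : Word Γ) → _∼_ Γ ṽ v × _⟶*_ Γ w̃ ṽ
mainTheorem2 Γ v w w̃ w⟶*v w̃∼w =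
  StepCommutation.commute-steps (Commute Γ) (_⟶_ Γ) (Commute-⟶-commutes Γ) w̃∼w w⟶*v
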